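{- Let $D$ be a finite directed graph. Suppose that each vertex $v$ of $D$ is assigned a list $L(v)$ of four colors, and that each color $x \in L(v)$ is assigned a real number $r_v(x)$ (the rank of $x$ in $L(v)$; ranks may be positive, negative, or zero). Assume that for every vertex $v$, $$\sum_{x \in L(v)} r_v(x) \geq 2 d^+(v).$$ Then there is a coloring $c$ of the vertices of $D$ with $c(v) \in L(v)$ for every vertex $v$, such that for every vertex $v$, the number of out-neighbors of $v$ colored $c(v)$ is at most $r_v(c(v))$.
   Context: For a vertex $v$ of a digraph $D$, $d^+(v)$ denotes the out-degree of $v$, i.e., the number of out-neighbors of $v$ (vertices $w$ such that $(v,w)$ is an arc of $D$).
   Formalization: The ranks $r_v(x)$ are rational numbers instead of real numbers. -}

module Defs where

open import Data.Nat using (ℕ; zero; suc; _*_)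
open import Data.Bool using (Bool; true; false; if_then_else_)
open import Data.Fin using (Fin; zero; suc)
open import Data.Integer using (+_)
open import Data.Rational using (ℚ; _/_; _+_)
open import Relation.Binary.PropositionalEquality using (_≡_)
open import Relation.Nullary using (¬_)
open import Relation.Nullary.Decidable using (⌊_⌋)
open import Data.Nat using (_≟_)

record Digraph (n : ℕ) : Set where
  field
    arc      : Fin n → Fin n → Bool
    loopless : ∀ v → arc v v ≡ false
open Digraph public

count : ∀ {n} → (Fin n → Bool) → ℕ
count {zero}  p = 0
count {suc n} p = (if p zero then 1 else 0) Data.Nat.+ count (λ i → p (suc i))

outdeg : ∀ {n} → Digraph n → Fin n → ℕ
outdeg D v = count (arc D v)

ℕtoℚ : ℕ → ℚ
ℕtoℚ m = (+ m) / 1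

sum4 : (Fin 4 → ℚ) → ℚ
sum4 f = f zero + (f (suc zero) + (f (suc (suc zero)) + f (suc (suc (suc zero)))))

Distinct4 : (Fin 4 → ℕ) → Set
Distinct4 L = ∀ i j → L i ≡ L j → i ≡ j

-- Given lists L and a choice k v of a position in L v (so the color
-- of v is c(v) = L v (k v)), the number of out-neighbours w of v with
-- c(w) = c(v).
sameColOut : ∀ {n} → Digraph n → (L : Fin n → Fin 4 → ℕ) → (k : Fin n → Fin 4) → Fin n → ℕ
sameColOut D L k v = count (λ w → if arc D v w then ⌊ L w (k w) ≟ L v (k v) ⌋ else false)

{-# OPTIONS --safe #-}
-- Weight the vertices by a nonzero stationary vector μ of the arc-weighted
-- walk, so that the μ-weighted in-degree of v is μ(v) d⁺(v), and take a
-- colouring minimising Φ = Σ_v μ(v) (#monochromatic out-arcs of v − r_v(c(v))).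
-- Recolouring a vertex v with μ(v) > 0 cannot decrease Φ.  Summed over the
-- colours of L(v), each arc at v is monochromatic for at most one of them, so
-- these changes add up to at most 2 μ(v) d⁺(v) − μ(v) Σ r_v ≤ 0, which forces
-- v to be satisfied.  The support of μ is closed under out-arcs, so the
-- remaining vertices are coloured by repeating the argument on them with the
-- satisfied ones frozen.

module Submission where

open import Defs
open import Data.Nat using (ℕ; _*_)
open import Data.Fin using (Fin)
open import Data.Product using (Σ; _×_)
open import Data.Rational using (ℚ; _≤_)

open import Algebra.Bundles using (Ring)
import Algebra.Properties.Semiring.Sum as SemiringSum
open import Data.Bool using (Bool; true; false; T; if_then_else_; _∧_)
import Data.Bool as Bool
open import Data.Bool.Properties using (¬-not)
open import Data.Empty using (⊥-elim)
open import Data.Fin using (zero; suc; punchIn)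
import Data.Fin as Fin
open import Data.Fin.Properties using (punchInᵢ≢i; any?; suc-injective)
import Data.Integer as ℤ
import Data.Integer.Properties as ℤₚ
open import Data.List using (allFin)
open import Data.List.Membership.Propositional.Properties using (∈-allFin)
import Data.List.Relation.Unary.All as All
open import Data.Nat as ℕ using (zero; suc; _+_; z≤n; s≤s; NonZero)
import Data.Nat.Coprimality as Coprimality
open import Data.Nat.Induction using (<-wellFounded)
import Data.Nat.Properties as ℕₚ
open import Data.Nat.Tactic.RingSolver using (solve-∀)
open import Data.Product using (∃-syntax; _,_; proj₁; proj₂)
import Data.Rational as ℚ
import Data.Rational.Properties as ℚₚ
open import Data.Rational.Solver using (module +-*-Solver)
import Data.Rational.Unnormalised as ℚᵘ
import Data.Rational.Unnormalised.Properties as ℚᵘₚ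
open import Data.Sum using (_⊎_; inj₁; inj₂; [_,_]′)
open import Data.Vec.Functional using (_∷_; tail; removeAt; updateAt)
open import Data.Vec.Functional.Properties using (updateAt-updates; updateAt-minimal)
open import Function using (_∘_; const)
open import Function.Definitions using (Injective)
open import Induction.WellFounded using (Acc; acc)
open import Relation.Binary.Bundles using (DecTotalOrder)
open import Relation.Binary.PropositionalEquality
open import Relation.Nullary using (Dec; yes; no)
open import Relation.Nullary.Decidable using (⌊_⌋; toWitness)

open import Algebra.Properties.Semiring.Sum ℕₚ.+-*-semiring
  using (sum; sum-cong-≗; sum-remove; sum-replicate-zero; ∑-distrib-+; ∑-comm; *-distribˡ-sum; *-distribʳ-sum)
module ℚΣ = SemiringSum (Ring.semiring ℚₚ.+-*-ring)

ℕtoℚ-mkℚ : ∀ m → ℕtoℚ m ≡ ℚ.mkℚ (ℤ.+ m) 0 (Coprimality.sym (Coprimality.1-coprimeTo m))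
ℕtoℚ-mkℚ m = ℚₚ.normalize-coprime (Coprimality.sym (Coprimality.1-coprimeTo m))

toℚᵘ-ℕtoℚ : ∀ m → ℚ.toℚᵘ (ℕtoℚ m) ≡ ℚᵘ.mkℚᵘ (ℤ.+ m) 0
toℚᵘ-ℕtoℚ m = cong ℚ.toℚᵘ (ℕtoℚ-mkℚ m)

ℕtoℚ-+ : ∀ a b → ℕtoℚ (a + b) ≡ ℕtoℚ a ℚ.+ ℕtoℚ b
ℕtoℚ-+ a b = ℚₚ.toℚᵘ-injective (begin
  ℚ.toℚᵘ (ℕtoℚ (a + b))                        ≡⟨ toℚᵘ-ℕtoℚ (a + b) ⟩
  ℚᵘ.mkℚᵘ (ℤ.+ (a + b)) 0                       ≈⟨ ℚᵘ.*≡* (cong (ℤ._* ℤ.+ 1) +[a+b]≡) ⟩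
  ℚᵘ.mkℚᵘ (ℤ.+ a) 0 ℚᵘ.+ ℚᵘ.mkℚᵘ (ℤ.+ b) 0       ≡⟨ cong₂ ℚᵘ._+_ (toℚᵘ-ℕtoℚ a) (toℚᵘ-ℕtoℚ b) ⟨
  ℚ.toℚᵘ (ℕtoℚ a) ℚᵘ.+ ℚ.toℚᵘ (ℕtoℚ b)          ≈⟨ ℚₚ.toℚᵘ-homo-+ (ℕtoℚ a) (ℕtoℚ b) ⟨
  ℚ.toℚᵘ (ℕtoℚ a ℚ.+ ℕtoℚ b)                    ∎)
  where
  open ℚᵘₚ.≃-Reasoning
  +[a+b]≡ : ℤ.+ (a + b) ≡ ℤ.+ a ℤ.* ℤ.+ 1 ℤ.+ ℤ.+ b ℤ.* ℤ.+ 1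
  +[a+b]≡ = trans (ℤₚ.pos-+ a b) (sym (cong₂ ℤ._+_ (ℤₚ.*-identityʳ (ℤ.+ a)) (ℤₚ.*-identityʳ (ℤ.+ b))))

ℕtoℚ-* : ∀ a b → ℕtoℚ (a * b) ≡ ℕtoℚ a ℚ.* ℕtoℚ b
ℕtoℚ-* a b = ℚₚ.toℚᵘ-injective (begin
  ℚ.toℚᵘ (ℕtoℚ (a * b))                        ≡⟨ toℚᵘ-ℕtoℚ (a * b) ⟩
  ℚᵘ.mkℚᵘ (ℤ.+ (a * b)) 0                       ≈⟨ ℚᵘ.*≡* (cong (ℤ._* ℤ.+ 1) (ℤₚ.pos-* a b)) ⟩
  ℚᵘ.mkℚᵘ (ℤ.+ a) 0 ℚᵘ.* ℚᵘ.mkℚᵘ (ℤ.+ b) 0       ≡⟨ cong₂ ℚᵘ._*_ (toℚᵘ-ℕtoℚ a) (toℚᵘ-ℕtoℚ b) ⟨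
  ℚ.toℚᵘ (ℕtoℚ a) ℚᵘ.* ℚ.toℚᵘ (ℕtoℚ b)          ≈⟨ ℚₚ.toℚᵘ-homo-* (ℕtoℚ a) (ℕtoℚ b) ⟨
  ℚ.toℚᵘ (ℕtoℚ a ℚ.* ℕtoℚ b)                    ∎)
  where open ℚᵘₚ.≃-Reasoning

ℕtoℚ-mono-≤ : ∀ {a b} → a ℕ.≤ b → ℕtoℚ a ≤ ℕtoℚ b
ℕtoℚ-mono-≤ {a} {b} a≤b = ℚₚ.toℚᵘ-cancel-≤ (subst₂ ℚᵘ._≤_ (sym (toℚᵘ-ℕtoℚ a)) (sym (toℚᵘ-ℕtoℚ b))
  (ℚᵘ.*≤* (ℤₚ.*-monoʳ-≤-nonNeg (ℤ.+ 1) (ℤ.+≤+ a≤b))))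

ℕtoℚ-nonNeg : ∀ m → ℚ.NonNegative (ℕtoℚ m)
ℕtoℚ-nonNeg m = subst ℚ.NonNegative (sym (ℕtoℚ-mkℚ m)) _

ℕtoℚ-pos : ∀ m .{{_ : NonZero m}} → ℚ.Positive (ℕtoℚ m)
ℕtoℚ-pos (suc m) = subst ℚ.Positive (sym (ℕtoℚ-mkℚ (suc m))) _

ℕtoℚ-sum : ∀ {s} (f : Fin s → ℕ) → ℕtoℚ (sum f) ≡ ℚΣ.sum (ℕtoℚ ∘ f)
ℕtoℚ-sum {zero}  f = refl
ℕtoℚ-sum {suc s} f = trans (ℕtoℚ-+ (f zero) _) (cong (ℕtoℚ (f zero) ℚ.+_) (ℕtoℚ-sum (tail f)))

sum-mono-≤ : ∀ {s} {f g : Fin s → ℕ} → (∀ i → f i ℕ.≤ g i) → sum f ℕ.≤ sum g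
sum-mono-≤ {zero}  f≤g = z≤n
sum-mono-≤ {suc s} f≤g = ℕₚ.+-mono-≤ (f≤g zero) (sum-mono-≤ (f≤g ∘ suc))

sum-mono-< : ∀ {s} {f g : Fin s → ℕ} → (∀ i → f i ℕ.≤ g i) → ∀ j → f j ℕ.< g j → sum f ℕ.< sum g
sum-mono-< {suc s} {f} {g} f≤g j fj<gj =
  subst₂ ℕ._<_ (sym (sum-remove {i = j} f)) (sym (sum-remove {i = j} g))
    (ℕₚ.+-mono-<-≤ fj<gj (sum-mono-≤ (f≤g ∘ punchIn j)))

≤-sum : ∀ {s} (f : Fin s → ℕ) i → f i ℕ.≤ sum f
≤-sum {suc s} f i = subst (f i ℕ.≤_) (sym (sum-remove {i = i} f)) (ℕₚ.m≤m+n (f i) _)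

sum-removeAt-≤ : ∀ {s} (f : Fin (suc s) → ℕ) i → sum (removeAt f i) ℕ.≤ sum f
sum-removeAt-≤ f i = subst (sum (removeAt f i) ℕ.≤_) (sym (sum-remove {i = i} f)) (ℕₚ.m≤n+m _ (f i))

ℚΣ-mono-≤ : ∀ {s} {f g : Fin s → ℚ} → (∀ i → f i ≤ g i) → ℚΣ.sum f ≤ ℚΣ.sum g
ℚΣ-mono-≤ {zero}  f≤g = ℚₚ.≤-refl
ℚΣ-mono-≤ {suc s} f≤g = ℚₚ.+-mono-≤ (f≤g zero) (ℚΣ-mono-≤ (f≤g ∘ suc))

ℚΣ-const : ∀ s a → ℚΣ.sum {s} (const a) ≡ ℕtoℚ s ℚ.* a
ℚΣ-const zero    a = sym (ℚₚ.*-zeroˡ a)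
ℚΣ-const (suc s) a = begin
  a ℚ.+ ℚΣ.sum {s} (const a)   ≡⟨ cong (a ℚ.+_) (ℚΣ-const s a) ⟩
  a ℚ.+ ℕtoℚ s ℚ.* a           ≡⟨ solve 2 (λ a ŝ → a :+ ŝ :* a := (con ℚ.1ℚ :+ ŝ) :* a) refl a (ℕtoℚ s) ⟩
  (ℚ.1ℚ ℚ.+ ℕtoℚ s) ℚ.* a      ≡⟨ cong (ℚ._* a) (ℕtoℚ-+ 1 s) ⟨
  ℕtoℚ (suc s) ℚ.* a           ∎
  where
  open ≡-Reasoning
  open +-*-Solver

+-cancelʳ-≤ : ∀ {x y} z → x ℚ.+ z ≤ y ℚ.+ z → x ≤ y
+-cancelʳ-≤ {x} {y} z x+z≤y+z = subst₂ _≤_ (cancel x) (cancel y) (ℚₚ.+-monoˡ-≤ (ℚ.- z) x+z≤y+z)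
  where
  open +-*-Solver
  cancel : ∀ w → w ℚ.+ z ℚ.- z ≡ w
  cancel w = solve 2 (λ w z → w :+ z :- z := w) refl w z

≤-by-averaging : ∀ {s} {a e : ℚ} (b c : Fin (suc s) → ℚ) →
                 (∀ y → a ℚ.+ b y ≤ c y ℚ.+ e) → ℚΣ.sum c ≤ ℚΣ.sum b → a ≤ e
≤-by-averaging {s} {a} {e} b c local Σc≤Σb =
  ℚₚ.*-cancelˡ-≤-pos (ℕtoℚ (suc s)) {{ℕtoℚ-pos (suc s)}}
    (subst₂ _≤_ (ℚΣ-const (suc s) a) (ℚΣ-const (suc s) e) (+-cancelʳ-≤ (ℚΣ.sum b) (begin
      A ℚ.+ ℚΣ.sum b                ≡⟨ ℚΣ.∑-distrib-+ (const a) b ⟨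
      ℚΣ.sum (λ y → a ℚ.+ b y)      ≤⟨ ℚΣ-mono-≤ local ⟩
      ℚΣ.sum (λ y → c y ℚ.+ e)      ≡⟨ ℚΣ.∑-distrib-+ c (const e) ⟩
      ℚΣ.sum c ℚ.+ E                ≤⟨ ℚₚ.+-monoˡ-≤ E Σc≤Σb ⟩
      ℚΣ.sum b ℚ.+ E                ≡⟨ ℚₚ.+-comm (ℚΣ.sum b) E ⟩
      E ℚ.+ ℚΣ.sum b                ∎)))
  where
  open ℚₚ.≤-Reasoning
  A E : ℚ
  A = ℚΣ.sum {suc s} (const a)
  E = ℚΣ.sum {suc s} (const e)

cancel-common-≤ : ∀ x x′ m ρ ρ′ q → (x ℚ.+ m) ℚ.- (ρ ℚ.+ q) ≤ (x′ ℚ.+ m) ℚ.- (ρ′ ℚ.+ q) →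
                  x ℚ.+ ρ′ ≤ x′ ℚ.+ ρ
cancel-common-≤ x x′ m ρ ρ′ q h = subst₂ _≤_
  (solve 6 (λ x x′ m ρ ρ′ q → ((x :+ m) :- (ρ :+ q)) :+ (ρ :+ ρ′ :+ q :- m) := x :+ ρ′) refl x x′ m ρ ρ′ q)
  (solve 6 (λ x x′ m ρ ρ′ q → ((x′ :+ m) :- (ρ′ :+ q)) :+ (ρ :+ ρ′ :+ q :- m) := x′ :+ ρ) refl x x′ m ρ ρ′ q)
  (ℚₚ.+-monoˡ-≤ (ρ ℚ.+ ρ′ ℚ.+ q ℚ.- m) h)
  where open +-*-Solver

ind : Bool → ℕ
ind b = if b then 1 else 0

count≡sum : ∀ {s} (p : Fin s → Bool) → count p ≡ sum (ind ∘ p)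
count≡sum {zero}  p = refl
count≡sum {suc s} p = cong (ind (p zero) +_) (count≡sum (p ∘ suc))

ind-∧-≤ : ∀ a b → ind (a ∧ b) ℕ.≤ ind a
ind-∧-≤ true  true  = ℕₚ.≤-refl
ind-∧-≤ true  false = z≤n
ind-∧-≤ false b     = z≤n

AtMostOne : ∀ {s} → (Fin s → Bool) → Set
AtMostOne p = ∀ {i j} → T (p i) → T (p j) → i ≡ j

sum-ind-≤1 : ∀ {s} (p : Fin s → Bool) → AtMostOne p → sum (ind ∘ p) ℕ.≤ 1
sum-ind-≤1 {zero}  p unique = z≤n
sum-ind-≤1 {suc s} p unique with p zero in p0
... | true  = s≤s (ℕₚ.≤-reflexive (trans (sum-cong-≗ none) (sum-replicate-zero s)))
  where
  none : ∀ i → ind (p (suc i)) ≡ 0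
  none i with p (suc i) in pi
  ... | false = refl
  ... | true  with () ← unique (subst T (sym p0) _) (subst T (sym pi) _)
... | false = sum-ind-≤1 (p ∘ suc) (λ pi pj → suc-injective (unique pi pj))

sum-ind-if-≤ : ∀ {s} b (p : Fin s → Bool) → AtMostOne p →
               sum (λ i → ind (if b then p i else false)) ℕ.≤ ind b
sum-ind-if-≤ {s} false p unique = ℕₚ.≤-reflexive (sum-replicate-zero s)
sum-ind-if-≤     true  p unique = sum-ind-≤1 p unique

argmin-Fin : ∀ {m} (f : Fin (suc m) → ℚ) → ∃[ a ] (∀ b → f a ≤ f b)
argmin-Fin {m} f = argmin f zero (allFin (suc m)) ,
  λ b → All.lookup (f[argmin]≤f[xs] {f = f} zero (allFin (suc m))) (∈-allFin b)
  where open import Data.List.Extrema (DecTotalOrder.totalOrder ℚₚ.≤-decTotalOrder)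

argmin-Vector : ∀ n {m} (f : (Fin n → Fin (suc m)) → ℚ) → (∀ {g h} → g ≗ h → f g ≡ f h) →
                ∃[ g ] (∀ h → f g ≤ f h)
argmin-Vector zero    f f-cong = (λ ()) , λ h → ℚₚ.≤-reflexive (f-cong (λ ()))
argmin-Vector (suc n) {m} f f-cong = a ∷ best a , λ h → begin
  f (a ∷ best a)             ≤⟨ a-min (h zero) ⟩
  f (h zero ∷ best (h zero)) ≤⟨ best-min (h zero) (tail h) ⟩
  f (h zero ∷ tail h)        ≡⟨ f-cong (λ { zero → refl ; (suc i) → refl }) ⟩
  f h                        ∎
  where
  open ℚₚ.≤-Reasoning
  ∷-cong : ∀ {a} {g h : Fin n → Fin (suc m)} → g ≗ h → (a ∷ g) ≗ (a ∷ h)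
  ∷-cong g≗h zero    = refl
  ∷-cong g≗h (suc i) = g≗h i
  best-after : ∀ a → ∃[ g ] (∀ h → f (a ∷ g) ≤ f (a ∷ h))
  best-after a = argmin-Vector n (λ g → f (a ∷ g)) (f-cong ∘ ∷-cong)
  best : Fin (suc m) → Fin n → Fin (suc m)
  best a = proj₁ (best-after a)
  best-min : ∀ a h → f (a ∷ best a) ≤ f (a ∷ h)
  best-min a = proj₂ (best-after a)
  a : Fin (suc m)
  a = proj₁ (argmin-Fin (λ a → f (a ∷ best a)))
  a-min : ∀ b → f (a ∷ best a) ≤ f (b ∷ best b)
  a-min = proj₂ (argmin-Fin (λ a → f (a ∷ best a)))

Stationary : ∀ {n} → (Fin n → Fin n → ℕ) → (Fin n → ℕ) → Set
Stationary W μ = ∀ v → sum (λ u → μ u * W u v) ≡ μ v * sum (W v)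

support-closed : ∀ {n} {W : Fin n → Fin n → ℕ} {μ} → Stationary W μ →
                 ∀ {u w} → μ u ≢ 0 → W u w ≢ 0 → μ w ≢ 0
support-closed {W = W} {μ} stationary {u} {w} μu≢0 Wuw≢0 μw≡0 =
  [ μu≢0 , Wuw≢0 ]′ (ℕₚ.m*n≡0⇒m≡0∨n≡0 (μ u) (ℕₚ.n≤0⇒n≡0 (begin
    μ u * W u w               ≤⟨ ≤-sum (λ u → μ u * W u w) u ⟩
    sum (λ u → μ u * W u w)   ≡⟨ stationary w ⟩
    μ w * sum (W w)           ≡⟨ cong (_* sum (W w)) μw≡0 ⟩
    0                         ∎)))
  where open ℕₚ.≤-Reasoning

δ₀ : ∀ {n} → Fin (suc n) → ℕ
δ₀ zero    = 1
δ₀ (suc _) = 0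

δ₀-stationary : ∀ {n} (W : Fin (suc n) → Fin (suc n) → ℕ) → sum (W zero ∘ suc) ≡ 0 → Stationary W δ₀
δ₀-stationary {n} W out≡0 zero = begin
  1 * W zero zero + sum {n} (const 0)    ≡⟨ cong₂ _+_ (ℕₚ.*-identityˡ _) (sum-replicate-zero n) ⟩
  W zero zero + 0                        ≡⟨ cong (W zero zero +_) out≡0 ⟨
  W zero zero + sum (W zero ∘ suc)       ≡⟨ ℕₚ.*-identityˡ _ ⟨
  1 * sum (W zero)                       ∎
  where open ≡-Reasoning
δ₀-stationary {n} W out≡0 (suc j) = begin
  1 * W zero (suc j) + sum {n} (const 0) ≡⟨ cong₂ _+_ (ℕₚ.*-identityˡ _) (sum-replicate-zero n) ⟩
  W zero (suc j) + 0                     ≡⟨ ℕₚ.+-identityʳ _ ⟩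
  W zero (suc j)                         ≡⟨ ℕₚ.n≤0⇒n≡0 (subst (W zero (suc j) ℕ.≤_) out≡0 (≤-sum (W zero ∘ suc) j)) ⟩
  0                                      ∎
  where open ≡-Reasoning

-- The chain censored at state 0: a detour u → 0 → w is folded into W′ u w,
-- everything scaled by the out-weight t of state 0 so that it stays in ℕ.
module Censor {n} (W : Fin (suc (suc n)) → Fin (suc (suc n)) → ℕ) where

  t : ℕ
  t = sum (W zero ∘ suc)

  W′ : Fin (suc n) → Fin (suc n) → ℕ
  W′ i j = t * W (suc i) (suc j) + W (suc i) zero * W zero (suc j)

  lift : (Fin (suc n) → ℕ) → Fin (suc (suc n)) → ℕ
  lift μ′ zero    = sum (λ i → μ′ i * W (suc i) zero)
  lift μ′ (suc i) = t * μ′ i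

  lift-stationary : ∀ {μ′} → Stationary W′ μ′ → Stationary W (lift μ′)
  lift-stationary {μ′} stationary zero = begin
    μ₀ * W zero zero + sum (λ i → t * μ′ i * W (suc i) zero)
      ≡⟨ cong (μ₀ * W zero zero +_) (trans (sum-cong-≗ (λ i → ℕₚ.*-assoc t (μ′ i) (W (suc i) zero)))
                                            (sym (*-distribˡ-sum t (λ i → μ′ i * W (suc i) zero)))) ⟩
    μ₀ * W zero zero + t * μ₀
      ≡⟨ cong (μ₀ * W zero zero +_) (ℕₚ.*-comm t μ₀) ⟩
    μ₀ * W zero zero + μ₀ * t
      ≡⟨ ℕₚ.*-distribˡ-+ μ₀ (W zero zero) t ⟨
    μ₀ * (W zero zero + t)
      ∎
    where
    open ≡-Reasoning
    μ₀ : ℕ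
    μ₀ = lift μ′ zero
  lift-stationary {μ′} stationary (suc j) = begin
    lift μ′ zero * W zero (suc j) + sum (λ i → t * μ′ i * W (suc i) (suc j))
      ≡⟨ cong (_+ sum (λ i → t * μ′ i * W (suc i) (suc j)))
              (*-distribʳ-sum (W zero (suc j)) (λ i → μ′ i * W (suc i) zero)) ⟩
    sum (λ i → μ′ i * W (suc i) zero * W zero (suc j)) + sum (λ i → t * μ′ i * W (suc i) (suc j))
      ≡⟨ ∑-distrib-+ (λ i → μ′ i * W (suc i) zero * W zero (suc j)) (λ i → t * μ′ i * W (suc i) (suc j)) ⟨
    sum (λ i → μ′ i * W (suc i) zero * W zero (suc j) + t * μ′ i * W (suc i) (suc j))
      ≡⟨ sum-cong-≗ (λ i → regroup (μ′ i) (W (suc i) zero) (W zero (suc j)) t (W (suc i) (suc j))) ⟩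
    sum (λ i → μ′ i * W′ i j)
      ≡⟨ stationary j ⟩
    μ′ j * sum (W′ j)
      ≡⟨ cong (μ′ j *_) (∑-distrib-+ (λ k → t * W (suc j) (suc k)) (λ k → W (suc j) zero * W zero (suc k))) ⟩
    μ′ j * (sum (λ k → t * W (suc j) (suc k)) + sum (λ k → W (suc j) zero * W zero (suc k)))
      ≡⟨ cong₂ (λ a b → μ′ j * (a + b)) (sym (*-distribˡ-sum t (λ k → W (suc j) (suc k))))
                                        (sym (*-distribˡ-sum (W (suc j) zero) (λ k → W zero (suc k)))) ⟩
    μ′ j * (t * sum (λ k → W (suc j) (suc k)) + W (suc j) zero * t)
      ≡⟨ regroup′ (μ′ j) t (sum (λ k → W (suc j) (suc k))) (W (suc j) zero) ⟩
    t * μ′ j * (W (suc j) zero + sum (λ k → W (suc j) (suc k)))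
      ∎
    where
    open ≡-Reasoning
    regroup : ∀ a b c t d → a * b * c + t * a * d ≡ a * (t * d + b * c)
    regroup = solve-∀
    regroup′ : ∀ a t s b → a * (t * s + b * t) ≡ t * a * (b + s)
    regroup′ = solve-∀

stationary-exists : ∀ n (W : Fin (suc n) → Fin (suc n) → ℕ) → ∃[ μ ] (∃[ i ] μ i ≢ 0) × Stationary W μ
stationary-exists zero    W = δ₀ , (zero , λ ()) , δ₀-stationary W refl
stationary-exists (suc n) W with sum (W zero ∘ suc) in t≡
... | zero  = δ₀ , (zero , λ ()) , δ₀-stationary W t≡
... | suc _ = lift-nontrivial (stationary-exists n W′)
  where
  open Censor W
  lift-nontrivial : ∃[ μ′ ] (∃[ i ] μ′ i ≢ 0) × Stationary W′ μ′ → ∃[ μ ] (∃[ i ] μ i ≢ 0) × Stationary W μ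
  lift-nontrivial (μ′ , (i , μ′i≢0) , stationary) = lift μ′ , (suc i , tμ′i≢0) , lift-stationary stationary
    where
    tμ′i≢0 : t * μ′ i ≢ 0
    tμ′i≢0 tμ′i≡0 = [ (λ t≡0 → ℕₚ.0≢1+n (trans (sym t≡0) t≡)) , μ′i≢0 ]′ (ℕₚ.m*n≡0⇒m≡0∨n≡0 t tμ′i≡0)

removeAt-updateAt : ∀ {A : Set} {n} (xs : Fin (suc n) → A) i f → removeAt (updateAt xs i f) i ≗ removeAt xs i
removeAt-updateAt xs i f j = updateAt-minimal (punchIn i j) i xs (punchInᵢ≢i i j)

≡ᵇ0-false : ∀ {m} → m ≢ 0 → (m ℕ.≡ᵇ 0) ≡ false
≡ᵇ0-false {zero}  m≢0 = ⊥-elim (m≢0 refl)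
≡ᵇ0-false {suc m} m≢0 = refl

≡ᵇ0-false⁻¹ : ∀ {m} → (m ℕ.≡ᵇ 0) ≡ false → m ≢ 0
≡ᵇ0-false⁻¹ {zero}  ()
≡ᵇ0-false⁻¹ {suc m} _ ()

true-or-false : ∀ b → b ≡ true ⊎ b ≡ false
true-or-false true  = inj₁ refl
true-or-false false = inj₂ refl

≡1⇒≢0 : ∀ {a} → a ≡ 1 → a ≢ 0
≡1⇒≢0 refl ()

glue : ∀ {A : Set} {n} → (Fin n → Bool) → (Fin n → A) → (Fin n → A) → Fin n → A
glue U g h w = if U w then g w else h w

glue-cong : ∀ {A : Set} {n} (U : Fin n → Bool) {g g′ h : Fin n → A} → g ≗ g′ → glue U g h ≗ glue U g′ h
glue-cong U {h = h} g≗g′ w = cong (λ c → if U w then c else h w) (g≗g′ w)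

glue-updateAt : ∀ {A : Set} {n} (U : Fin n → Bool) (g h : Fin n → A) {v} y → U v ≡ true →
                glue U (updateAt g v (const y)) h ≗ updateAt (glue U g h) v (const y)
glue-updateAt U g h {v} y v∈U w with w Fin.≟ v
... | yes refl = trans (cong (λ b → if b then updateAt g w (const y) w else h w) v∈U)
                       (trans (updateAt-updates w g) (sym (updateAt-updates w (glue U g h))))
... | no  w≢v  = trans (cong (λ c → if U w then c else h w) (updateAt-minimal w v g w≢v))
                       (sym (updateAt-minimal w v (glue U g h) w≢v))

module ListColouring {n m : ℕ} (D : Digraph (suc n)) (L : Fin (suc n) → Fin (suc m) → ℕ)
  (r : Fin (suc n) → Fin (suc m) → ℚ) (L-injective : ∀ v → Injective _≡_ _≡_ (L v))
  (r-large : ∀ v → ℕtoℚ (2 * outdeg D v) ≤ ℚΣ.sum (r v)) where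

  Vertex : Set
  Vertex = Fin (suc n)

  Choice : Set
  Choice = Vertex → Fin (suc m)

  colour : Choice → Vertex → ℕ
  colour k v = L v (k v)

  monoArc : Choice → Vertex → Vertex → Bool
  monoArc k u w = if arc D u w then ⌊ colour k w ℕ.≟ colour k u ⌋ else false

  Satisfied : Choice → Vertex → Set
  Satisfied k v = ℕtoℚ (count (monoArc k v)) ≤ r v (k v)

  monoArc-cong : ∀ {k k′} u w → k u ≡ k′ u → k w ≡ k′ w → monoArc k u w ≡ monoArc k′ u w
  monoArc-cong u w = cong₂ (λ a b → if arc D u w then ⌊ L w b ℕ.≟ L u a ⌋ else false)

  satisfied-cong : ∀ {k k′ v} → k v ≡ k′ v → (∀ w → arc D v w ≡ true → k w ≡ k′ w) → Satisfied k v → Satisfied k′ v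
  satisfied-cong {k} {k′} {v} kv≡ out≡ = subst₂ (λ c ρ → ℕtoℚ c ≤ ρ)
    (trans (count≡sum (monoArc k v)) (trans (sum-cong-≗ same) (sym (count≡sum (monoArc k′ v)))))
    (cong (r v) kv≡)
    where
    same : ∀ w → ind (monoArc k v w) ≡ ind (monoArc k′ v w)
    same w with arc D v w in v→w
    ... | false = refl
    ... | true  = cong₂ (λ a b → ind ⌊ L w b ℕ.≟ L v a ⌋) kv≡ (out≡ w v→w)

  colour-unique : ∀ v z → AtMostOne (λ y → ⌊ z ℕ.≟ L v y ⌋)
  colour-unique v z p q = L-injective v (trans (sym (toWitness p)) (toWitness q))

  colour-unique′ : ∀ v z → AtMostOne (λ y → ⌊ L v y ℕ.≟ z ⌋)
  colour-unique′ v z p q = L-injective v (trans (toWitness p) (sym (toWitness q)))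

  module Potential (μ : Vertex → ℕ) where

    monoInd : Choice → Vertex → Vertex → ℕ
    monoInd k u = ind ∘ monoArc k u

    N : Choice → ℕ
    N k = sum (λ u → μ u * sum (monoInd k u))

    R : Choice → ℚ
    R k = ℚΣ.sum (λ u → ℕtoℚ (μ u) ℚ.* r u (k u))

    -- Opaque: conversion checks that unfold Φ normalise the rational
    -- arithmetic inside it, which is prohibitively slow.
    opaque
      Φ : Choice → ℚ
      Φ k = ℕtoℚ (N k) ℚ.- R k

    N-cong : ∀ {k k′} → k ≗ k′ → N k ≡ N k′
    N-cong k≗k′ = sum-cong-≗ (λ u → cong (μ u *_)
      (sum-cong-≗ (λ w → cong ind (monoArc-cong u w (k≗k′ u) (k≗k′ w)))))

    R-cong : ∀ {k k′} → k ≗ k′ → R k ≡ R k′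
    R-cong k≗k′ = ℚΣ.sum-cong-≗ (λ u → cong (λ y → ℕtoℚ (μ u) ℚ.* r u y) (k≗k′ u))

    opaque
      unfolding Φ
      Φ-cong : ∀ {k k′} → k ≗ k′ → Φ k ≡ Φ k′
      Φ-cong {k} {k′} k≗k′ = begin
        ℕtoℚ (N k) ℚ.- R k    ≡⟨ cong (λ a → ℕtoℚ a ℚ.- R k) (N-cong {k} {k′} k≗k′) ⟩
        ℕtoℚ (N k′) ℚ.- R k   ≡⟨ cong (λ b → ℕtoℚ (N k′) ℚ.- b) (R-cong {k} {k′} k≗k′) ⟩
        ℕtoℚ (N k′) ℚ.- R k′  ∎
        where open ≡-Reasoning

    module At (v : Vertex) where

      X : Choice → ℕ
      X k = μ v * sum (monoInd k v) + sum (λ i → μ (punchIn v i) * monoInd k (punchIn v i) v)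

      M : Choice → ℕ
      M k = sum (λ i → μ (punchIn v i) * sum (λ j → monoInd k (punchIn v i) (punchIn v j)))

      Q : Choice → ℚ
      Q k = ℚΣ.sum (λ i → ℕtoℚ (μ (punchIn v i)) ℚ.* r (punchIn v i) (k (punchIn v i)))

      N-split : ∀ k → N k ≡ X k + M k
      N-split k = begin
        N k
          ≡⟨ sum-remove {i = v} (λ u → μ u * sum (monoInd k u)) ⟩
        μ v * sum (monoInd k v) + sum (λ i → μ (v↑ i) * sum (monoInd k (v↑ i)))
          ≡⟨ cong (μ v * sum (monoInd k v) +_) (trans (sum-cong-≗ split) (∑-distrib-+ into from)) ⟩
        μ v * sum (monoInd k v) + (sum into + M k)
          ≡⟨ ℕₚ.+-assoc (μ v * sum (monoInd k v)) (sum into) (M k) ⟨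
        X k + M k
          ∎
        where
        open ≡-Reasoning
        v↑ : Fin n → Vertex
        v↑ = punchIn v
        into from : Fin n → ℕ
        into i = μ (v↑ i) * monoInd k (v↑ i) v
        from i = μ (v↑ i) * sum (λ j → monoInd k (v↑ i) (v↑ j))
        split : ∀ i → μ (v↑ i) * sum (monoInd k (v↑ i)) ≡ into i + from i
        split i = trans (cong (μ (v↑ i) *_) (sum-remove {i = v} (monoInd k (v↑ i))))
                        (ℕₚ.*-distribˡ-+ (μ (v↑ i)) (monoInd k (v↑ i) v) (sum (λ j → monoInd k (v↑ i) (v↑ j))))

      M-cong : ∀ {k k′} → removeAt k v ≗ removeAt k′ v → M k ≡ M k′
      M-cong {k} {k′} agree = sum-cong-≗ (λ i → cong (μ (punchIn v i) *_)
        (sum-cong-≗ (λ j → cong ind (monoArc-cong {k} {k′} (punchIn v i) (punchIn v j) (agree i) (agree j)))))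

      Q-cong : ∀ {k k′} → removeAt k v ≗ removeAt k′ v → Q k ≡ Q k′
      Q-cong agree = ℚΣ.sum-cong-≗ (λ i →
        cong (λ y → ℕtoℚ (μ (punchIn v i)) ℚ.* r (punchIn v i) y) (agree i))

      opaque
        unfolding Φ
        Φ-split : ∀ k → Φ k ≡ (ℕtoℚ (X k) ℚ.+ ℕtoℚ (M k)) ℚ.- (ℕtoℚ (μ v) ℚ.* r v (k v) ℚ.+ Q k)
        Φ-split k = begin
          ℕtoℚ (N k) ℚ.- R k
            ≡⟨ cong (λ a → ℕtoℚ a ℚ.- R k) (N-split k) ⟩
          ℕtoℚ (X k + M k) ℚ.- R k
            ≡⟨ cong (λ a → a ℚ.- R k) (ℕtoℚ-+ (X k) (M k)) ⟩
          (ℕtoℚ (X k) ℚ.+ ℕtoℚ (M k)) ℚ.- R k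
            ≡⟨ cong (λ b → (ℕtoℚ (X k) ℚ.+ ℕtoℚ (M k)) ℚ.- b)
                    (ℚΣ.sum-remove {i = v} (λ u → ℕtoℚ (μ u) ℚ.* r u (k u))) ⟩
          (ℕtoℚ (X k) ℚ.+ ℕtoℚ (M k)) ℚ.- (ℕtoℚ (μ v) ℚ.* r v (k v) ℚ.+ Q k)
            ∎
          where open ≡-Reasoning

      Φ-local : ∀ {k k′} → removeAt k v ≗ removeAt k′ v → Φ k ≤ Φ k′ →
                ℕtoℚ (X k) ℚ.+ ℕtoℚ (μ v) ℚ.* r v (k′ v) ≤ ℕtoℚ (X k′) ℚ.+ ℕtoℚ (μ v) ℚ.* r v (k v)
      Φ-local {k} {k′} agree Φk≤Φk′ = cancel-common-≤ (ℕtoℚ (X k)) (ℕtoℚ (X k′)) (ℕtoℚ (M k)) (ρ k) (ρ k′) (Q k)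
        (subst₂ _≤_ (Φ-split k) Φk′≡ Φk≤Φk′)
        where
        ρ : Choice → ℚ
        ρ k = ℕtoℚ (μ v) ℚ.* r v (k v)
        Φk′≡ : Φ k′ ≡ (ℕtoℚ (X k′) ℚ.+ ℕtoℚ (M k)) ℚ.- (ρ k′ ℚ.+ Q k)
        Φk′≡ = begin
          Φ k′
            ≡⟨ Φ-split k′ ⟩
          (ℕtoℚ (X k′) ℚ.+ ℕtoℚ (M k′)) ℚ.- (ρ k′ ℚ.+ Q k′)
            ≡⟨ cong (λ a → (ℕtoℚ (X k′) ℚ.+ ℕtoℚ a) ℚ.- (ρ k′ ℚ.+ Q k′)) (M-cong {k′} {k} (sym ∘ agree)) ⟩
          (ℕtoℚ (X k′) ℚ.+ ℕtoℚ (M k)) ℚ.- (ρ k′ ℚ.+ Q k′)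
            ≡⟨ cong (λ b → (ℕtoℚ (X k′) ℚ.+ ℕtoℚ (M k)) ℚ.- (ρ k′ ℚ.+ b)) (Q-cong {k′} {k} (sym ∘ agree)) ⟩
          (ℕtoℚ (X k′) ℚ.+ ℕtoℚ (M k)) ℚ.- (ρ k′ ℚ.+ Q k)
            ∎
          where open ≡-Reasoning

      module _ (k : Choice) where

        private
          k[_] : Fin (suc m) → Choice
          k[ y ] = updateAt k v (const y)

        out-match : Fin (suc m) → Vertex → ℕ
        out-match y w = ind (if arc D v w then ⌊ colour k w ℕ.≟ L v y ⌋ else false)

        in-match : Fin (suc m) → Fin n → ℕ
        in-match y i = ind (if arc D (punchIn v i) v then ⌊ L v y ℕ.≟ colour k (punchIn v i) ⌋ else false)

        monoInd-update-out : ∀ y w → monoInd k[ y ] v w ≡ out-match y w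
        monoInd-update-out y w with w Fin.≟ v
        ... | yes refl rewrite loopless D v = refl
        ... | no  w≢v  = cong₂ (λ a b → ind (if arc D v w then ⌊ L w a ℕ.≟ L v b ⌋ else false))
                               (updateAt-minimal w v k w≢v) (updateAt-updates v k)

        monoInd-update-in : ∀ y i → monoInd k[ y ] (punchIn v i) v ≡ in-match y i
        monoInd-update-in y i =
          cong₂ (λ a b → ind (if arc D (punchIn v i) v then ⌊ L v a ℕ.≟ L (punchIn v i) b ⌋ else false))
                (updateAt-updates v k) (removeAt-updateAt k v (const y) i)

        X-update-sum : sum (λ y → X k[ y ]) ℕ.≤ μ v * outdeg D v + sum (λ u → μ u * ind (arc D u v))
        X-update-sum = begin
          sum (λ y → X k[ y ])
            ≡⟨ sum-cong-≗ (λ y → cong₂ (λ a b → μ v * a + b) (sum-cong-≗ (monoInd-update-out y))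
                                    (sum-cong-≗ (λ i → cong (μ (v↑ i) *_) (monoInd-update-in y i)))) ⟩
          sum (λ y → μ v * sum (out-match y) + sum (λ i → μ (v↑ i) * in-match y i))
            ≡⟨ ∑-distrib-+ (λ y → μ v * sum (out-match y)) (λ y → sum (λ i → μ (v↑ i) * in-match y i)) ⟩
          sum (λ y → μ v * sum (out-match y)) + sum (λ y → sum (λ i → μ (v↑ i) * in-match y i))
            ≡⟨ cong₂ _+_ (trans (sym (*-distribˡ-sum (μ v) (λ y → sum (out-match y))))
                                (cong (μ v *_) (∑-comm out-match)))
                         (∑-comm (λ y i → μ (v↑ i) * in-match y i)) ⟩
          μ v * sum (λ w → sum (λ y → out-match y w)) + sum (λ i → sum (λ y → μ (v↑ i) * in-match y i))
            ≤⟨ ℕₚ.+-mono-≤ (ℕₚ.*-monoʳ-≤ (μ v) (sum-mono-≤ out≤)) (sum-mono-≤ in≤) ⟩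
          μ v * sum (ind ∘ arc D v) + sum (λ i → μ (v↑ i) * ind (arc D (v↑ i) v))
            ≤⟨ ℕₚ.+-mono-≤ (ℕₚ.≤-reflexive (cong (μ v *_) (sym (count≡sum (arc D v)))))
                           (sum-removeAt-≤ (λ u → μ u * ind (arc D u v)) v) ⟩
          μ v * outdeg D v + sum (λ u → μ u * ind (arc D u v))
            ∎
          where
          open ℕₚ.≤-Reasoning
          v↑ : Fin n → Vertex
          v↑ = punchIn v
          out≤ : ∀ w → sum (λ y → out-match y w) ℕ.≤ ind (arc D v w)
          out≤ w = sum-ind-if-≤ (arc D v w) _ (colour-unique v (colour k w))
          in≤ : ∀ i → sum (λ y → μ (v↑ i) * in-match y i) ℕ.≤ μ (v↑ i) * ind (arc D (v↑ i) v)
          in≤ i = begin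
            sum (λ y → μ (v↑ i) * in-match y i)
              ≡⟨ *-distribˡ-sum (μ (v↑ i)) (λ y → in-match y i) ⟨
            μ (v↑ i) * sum (λ y → in-match y i)
              ≤⟨ ℕₚ.*-monoʳ-≤ (μ (v↑ i)) (sum-ind-if-≤ (arc D (v↑ i) v) _ (colour-unique′ v (colour k (v↑ i)))) ⟩
            μ (v↑ i) * ind (arc D (v↑ i) v)
              ∎

        satisfied-at-local-minimum : μ v ≢ 0 → sum (λ u → μ u * ind (arc D u v)) ℕ.≤ μ v * outdeg D v →
                                 (∀ y → Φ k ≤ Φ k[ y ]) → Satisfied k v
        satisfied-at-local-minimum μv≢0 in≤out minimal =
          ℚₚ.*-cancelˡ-≤-pos μ̂ {{ℕtoℚ-pos (μ v) {{ℕ.≢-nonZero μv≢0}}}} (begin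
            μ̂ ℚ.* ℕtoℚ (count (monoArc k v))  ≡⟨ ℕtoℚ-* (μ v) (count (monoArc k v)) ⟨
            ℕtoℚ (μ v * count (monoArc k v))  ≤⟨ ℕtoℚ-mono-≤ own≤X ⟩
            ℕtoℚ (X k)                        ≤⟨ ≤-by-averaging (λ y → μ̂ ℚ.* r v y) (λ y → ℕtoℚ (X k[ y ]))
                                                                  local total ⟩
            μ̂ ℚ.* r v (k v)                   ∎)
          where
          open ℚₚ.≤-Reasoning
          μ̂ : ℚ
          μ̂ = ℕtoℚ (μ v)
          d : ℕ
          d = outdeg D v
          own≤X : μ v * count (monoArc k v) ℕ.≤ X k
          own≤X = subst (λ c → μ v * c ℕ.≤ X k) (sym (count≡sum (monoArc k v))) (ℕₚ.m≤m+n _ _)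
          local : ∀ y → ℕtoℚ (X k) ℚ.+ μ̂ ℚ.* r v y ≤ ℕtoℚ (X k[ y ]) ℚ.+ μ̂ ℚ.* r v (k v)
          local y = subst (λ z → ℕtoℚ (X k) ℚ.+ μ̂ ℚ.* r v z ≤ ℕtoℚ (X k[ y ]) ℚ.+ μ̂ ℚ.* r v (k v))
            (updateAt-updates v k) (Φ-local {k} {k[ y ]} (sym ∘ removeAt-updateAt k v (const y)) (minimal y))
          double : ∀ a d → a * d + a * d ≡ a * (2 * d)
          double = solve-∀
          ΣX≤ : sum (λ y → X k[ y ]) ℕ.≤ μ v * (2 * d)
          ΣX≤ = ℕₚ.≤-trans X-update-sum
                  (ℕₚ.≤-trans (ℕₚ.+-monoʳ-≤ (μ v * d) in≤out) (ℕₚ.≤-reflexive (double (μ v) d)))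
          total : ℚΣ.sum (λ y → ℕtoℚ (X k[ y ])) ≤ ℚΣ.sum (λ y → μ̂ ℚ.* r v y)
          total = begin
            ℚΣ.sum (λ y → ℕtoℚ (X k[ y ]))  ≡⟨ ℕtoℚ-sum (λ y → X k[ y ]) ⟨
            ℕtoℚ (sum (λ y → X k[ y ]))     ≤⟨ ℕtoℚ-mono-≤ ΣX≤ ⟩
            ℕtoℚ (μ v * (2 * d))            ≡⟨ ℕtoℚ-* (μ v) (2 * d) ⟩
            μ̂ ℚ.* ℕtoℚ (2 * d)              ≤⟨ ℚₚ.*-monoˡ-≤-nonNeg μ̂ {{ℕtoℚ-nonNeg (μ v)}} (r-large v) ⟩
            μ̂ ℚ.* ℚΣ.sum (r v)              ≡⟨ ℚΣ.*-distribˡ-sum μ̂ (r v) ⟩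
            ℚΣ.sum (λ y → μ̂ ℚ.* r v y)      ∎

  -- The arc weights of the walk used while U is still uncoloured: arcs
  -- leaving U are dropped and every vertex outside U gets a unit arc to each
  -- vertex of U, so the support of a stationary vector must meet U.
  flow : Bool → Bool → Bool → ℕ
  flow true  true  a = ind a
  flow true  false _ = 0
  flow false true  _ = 1
  flow false false _ = 0

  flow-true≤ : ∀ b a → flow true b a ℕ.≤ ind a
  flow-true≤ true  a = ℕₚ.≤-refl
  flow-true≤ false a = z≤n

  ind≤flow : ∀ b a → ind a ℕ.≤ flow b true a
  ind≤flow true  a     = ℕₚ.≤-refl
  ind≤flow false true  = ℕₚ.≤-refl
  ind≤flow false false = z≤n

  Settled : (Vertex → Bool) → Choice → Set
  Settled U k = ∀ w → U w ≡ false → Satisfied k w × (∀ x → arc D w x ≡ true → U x ≡ false)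

  module Step (U : Vertex → Bool) (k₀ : Choice) (settled : Settled U k₀) (v₀ : Vertex) (v₀∈U : U v₀ ≡ true) where

    W : Vertex → Vertex → ℕ
    W u w = flow (U u) (U w) (arc D u w)

    W-outside→U : ∀ {u w} → U u ≡ false → U w ≡ true → W u w ≡ 1
    W-outside→U {u} {w} u∉U w∈U = cong₂ (λ a b → flow a b (arc D u w)) u∉U w∈U

    W-arc-in-U : ∀ {u w} → U u ≡ true → U w ≡ true → arc D u w ≡ true → W u w ≡ 1
    W-arc-in-U {u} {w} u∈U w∈U u→w = trans (cong₂ (λ a b → flow a b (arc D u w)) u∈U w∈U) (cong ind u→w)

    arc≤W : ∀ u {v} → U v ≡ true → ind (arc D u v) ℕ.≤ W u v
    arc≤W u {v} v∈U =
      subst (λ b → ind (arc D u v) ℕ.≤ flow (U u) b (arc D u v)) (sym v∈U) (ind≤flow (U u) (arc D u v))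

    W≤arc : ∀ {v} → U v ≡ true → ∀ w → W v w ℕ.≤ ind (arc D v w)
    W≤arc {v} v∈U w =
      subst (λ b → flow b (U w) (arc D v w) ℕ.≤ ind (arc D v w)) (sym v∈U) (flow-true≤ (U w) (arc D v w))

    μ : Vertex → ℕ
    μ = proj₁ (stationary-exists n W)

    μ-nontrivial : ∃[ i ] μ i ≢ 0
    μ-nontrivial = proj₁ (proj₂ (stationary-exists n W))

    stationary : Stationary W μ
    stationary = proj₂ (proj₂ (stationary-exists n W))

    open Potential μ

    in-weight≤out-weight : ∀ {v} → U v ≡ true → sum (λ u → μ u * ind (arc D u v)) ℕ.≤ μ v * outdeg D v
    in-weight≤out-weight {v} v∈U = begin
      sum (λ u → μ u * ind (arc D u v))  ≤⟨ sum-mono-≤ (λ u → ℕₚ.*-monoʳ-≤ (μ u) (arc≤W u v∈U)) ⟩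
      sum (λ u → μ u * W u v)            ≡⟨ stationary v ⟩
      μ v * sum (W v)                    ≤⟨ ℕₚ.*-monoʳ-≤ (μ v) (sum-mono-≤ (W≤arc v∈U)) ⟩
      μ v * sum (ind ∘ arc D v)          ≡⟨ cong (μ v *_) (count≡sum (arc D v)) ⟨
      μ v * outdeg D v                   ∎
      where open ℕₚ.≤-Reasoning

    support-meets-U : ∃[ v ] U v ≡ true × μ v ≢ 0
    support-meets-U = meets μ-nontrivial
      where
      meets : ∃[ i ] μ i ≢ 0 → ∃[ v ] U v ≡ true × μ v ≢ 0
      meets (i , μi≢0) =
        [ (λ i∈U → i , i∈U , μi≢0)
        , (λ i∉U → v₀ , v₀∈U ,
                   support-closed {W = W} {μ} stationary μi≢0 (≡1⇒≢0 (W-outside→U i∉U v₀∈U)))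
        ]′ (true-or-false (U i))

    support-closed-in-U : ∀ {w x} → U w ≡ true → μ w ≢ 0 → arc D w x ≡ true → U x ≡ true → μ x ≢ 0
    support-closed-in-U w∈U μw≢0 w→x x∈U =
      support-closed {W = W} {μ} stationary μw≢0 (≡1⇒≢0 (W-arc-in-U w∈U x∈U w→x))

    best : ∃[ g ] (∀ h → Φ (glue U g k₀) ≤ Φ (glue U h k₀))
    best = argmin-Vector (suc n) (λ g → Φ (glue U g k₀))
                         (λ {g} {h} g≗h → Φ-cong {glue U g k₀} {glue U h k₀} (glue-cong U g≗h))

    k₁ : Choice
    k₁ = glue U (proj₁ best) k₀

    k₁-outside : ∀ {w} → U w ≡ false → k₁ w ≡ k₀ w
    k₁-outside {w} w∉U = cong (λ b → if b then proj₁ best w else k₀ w) w∉U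

    k₁-locally-minimal : ∀ {v} → U v ≡ true → ∀ y → Φ k₁ ≤ Φ (updateAt k₁ v (const y))
    k₁-locally-minimal {v} v∈U y = subst (Φ k₁ ≤_)
      (Φ-cong {glue U (updateAt (proj₁ best) v (const y)) k₀} {updateAt k₁ v (const y)}
              (glue-updateAt U (proj₁ best) k₀ y v∈U))
      (proj₂ best (updateAt (proj₁ best) v (const y)))

    satisfied-in-support : ∀ {v} → U v ≡ true → μ v ≢ 0 → Satisfied k₁ v
    satisfied-in-support {v} v∈U μv≢0 =
      At.satisfied-at-local-minimum v k₁ μv≢0 (in-weight≤out-weight v∈U) (k₁-locally-minimal v∈U)

    U′ : Vertex → Bool
    U′ w = U w ∧ (μ w ℕ.≡ᵇ 0)

    settled′ : Settled U′ k₁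
    settled′ w w∉U′ = [ inside , outside ]′ (true-or-false (U w))
      where
      outside : U w ≡ false → Satisfied k₁ w × (∀ x → arc D w x ≡ true → U′ x ≡ false)
      outside w∉U = satisfied-cong {k₀} {k₁} {w} (sym (k₁-outside w∉U)) (λ x w→x → sym (k₁-outside (out x w→x)))
                               (proj₁ (settled w w∉U))
                  , λ x w→x → cong (_∧ (μ x ℕ.≡ᵇ 0)) (out x w→x)
        where out = proj₂ (settled w w∉U)
      inside : U w ≡ true → Satisfied k₁ w × (∀ x → arc D w x ≡ true → U′ x ≡ false)
      inside w∈U = satisfied-in-support w∈U μw≢0 , λ x w→x →
        [ (λ x∈U → cong₂ _∧_ x∈U (≡ᵇ0-false (support-closed-in-U w∈U μw≢0 w→x x∈U)))
        , (λ x∉U → cong (_∧ (μ x ℕ.≡ᵇ 0)) x∉U)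
        ]′ (true-or-false (U x))
        where
        μw≢0 : μ w ≢ 0
        μw≢0 = ≡ᵇ0-false⁻¹ (trans (cong (_∧ (μ w ℕ.≡ᵇ 0)) (sym w∈U)) w∉U′)

    shrinks : count U′ ℕ.< count U
    shrinks with v₁ , v₁∈U , μv₁≢0 ← support-meets-U =
      subst₂ ℕ._<_ (sym (count≡sum U′)) (sym (count≡sum U))
        (sum-mono-< (λ w → ind-∧-≤ (U w) (μ w ℕ.≡ᵇ 0)) v₁
          (subst₂ (λ a b → ind (a ∧ b) ℕ.< ind a) (sym v₁∈U) (sym (≡ᵇ0-false μv₁≢0)) ℕₚ.≤-refl))

  complete-colouring : ∀ U → Acc ℕ._<_ (count U) → ∀ k₀ → Settled U k₀ → ∃[ k ] (∀ v → Satisfied k v)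
  complete-colouring U (acc rec) k₀ settled = by-cases (any? (λ v → U v Bool.≟ true))
    where
    by-cases : Dec (∃[ v ] U v ≡ true) → ∃[ k ] (∀ v → Satisfied k v)
    by-cases (no  U-empty)       = k₀ , λ v → proj₁ (settled v (¬-not (λ v∈U → U-empty (v , v∈U))))
    by-cases (yes (v₀ , v₀∈U)) = complete-colouring U′ (rec shrinks) k₁ settled′
      where open Step U k₀ settled v₀ v₀∈U

  list-colouring : ∃[ k ] (∀ v → Satisfied k v)
  list-colouring = complete-colouring (const true) (<-wellFounded _) (const zero) (λ _ ())

sum4≡sum : ∀ (f : Fin 4 → ℚ) → sum4 f ≡ ℚΣ.sum f
sum4≡sum f = cong (λ x → f zero ℚ.+ (f (suc zero) ℚ.+ (f (suc (suc zero)) ℚ.+ x))) (sym (ℚₚ.+-identityʳ _))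

theorem1 : (n : ℕ) (D : Digraph n) (L : Fin n → Fin 4 → ℕ) (r : Fin n → Fin 4 → ℚ)
    → (∀ v → Distinct4 (L v))
    → (∀ v → ℕtoℚ (2 * outdeg D v) ≤ sum4 (r v))
    → Σ (Fin n → Fin 4) (λ k → ∀ v → ℕtoℚ (sameColOut D L k v) ≤ r v (k v))
theorem1 zero    D L r distinct large = (λ ()) , (λ ())
theorem1 (suc n) D L r distinct large = list-colouring
  where
  open ListColouring D L r (λ v {i} {j} → distinct v i j)
                           (λ v → subst (ℕtoℚ (2 * outdeg D v) ≤_) (sum4≡sum (r v)) (large v))
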